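{- Let $\mathbf{C}$ be a quasitopos, let $t_L:L\to L'$ and $m:L\to G_L$ be regular monomorphisms, and suppose $t_L$ is a restricted classifier. Then there is at most one morphism $\alpha:G_L\to L'$ such that $\alpha\circ m=t_L$ and the square $L\xleftarrow{1_L}L\xrightarrow{m}G_L$ over $L\xrightarrow{t_L}L'\xleftarrow{\alpha}G_L$ is a pullback.
   Context: A quasitopos is a category with all finite limits and colimits that is locally cartesian closed and has a regular-subobject classifier. Its regular monos form a stable system of monics $\mathcal{M}$, and it has an $\mathcal{M}$-partial map classifier $(T,\eta)$: a functor $T$ and natural transformation $\eta:\mathrm{Id}\to T$ with each $\eta_X\in\mathcal{M}$ such that for every span $A\xleftarrow{m}X\xrightarrow{f}B$ with $m\in\mathcal{M}$ there is a unique $[m,f]:A\to T(B)$ making $\eta_B\circ f=[m,f]\circ m$ a pullback. A regular mono $t_L:L\to L'$ is a restricted classifier if there exists a monomorphism $s:L'\to T(L)$ with $s\circ t_L=\eta_L$. -}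

module Defs where

open import Level using (Level; _⊔_; suc)
open import Data.Product using (Σ; _×_; _,_)
open import Relation.Binary using (IsEquivalence)

record Category (o ℓ e : Level) : Set (suc (o ⊔ ℓ ⊔ e)) where
  infixr 9 _∘_
  infix  4 _≈_
  field
    Obj   : Set o
    Hom   : Obj → Obj → Set ℓ
    _≈_   : ∀ {A B} → Hom A B → Hom A B → Set e
    id    : ∀ {A} → Hom A A
    _∘_   : ∀ {A B C} → Hom B C → Hom A B → Hom A C
    ≈-equiv : ∀ {A B} → IsEquivalence (_≈_ {A} {B})
    ∘-resp-≈ : ∀ {A B C} {f h : Hom B C} {g i : Hom A B} → f ≈ h → g ≈ i → f ∘ g ≈ h ∘ i
    identityˡ : ∀ {A B} {f : Hom A B} → id ∘ f ≈ f
    identityʳ : ∀ {A B} {f : Hom A B} → f ∘ id ≈ f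
    assoc : ∀ {A B C D} {f : Hom A B} {g : Hom B C} {h : Hom C D} →
            (h ∘ g) ∘ f ≈ h ∘ (g ∘ f)

module Notions {o ℓ e} (C : Category o ℓ e) where
  open Category C

  Mono : ∀ {A B} → Hom A B → Set (o ⊔ ℓ ⊔ e)
  Mono {A} f = ∀ {Z} (g h : Hom Z A) → f ∘ g ≈ f ∘ h → g ≈ h

  IsEqualizer : ∀ {E A B} → Hom E A → Hom A B → Hom A B → Set (o ⊔ ℓ ⊔ e)
  IsEqualizer {E} {A} m f g =
    (f ∘ m ≈ g ∘ m) ×
    (∀ {Z} (h : Hom Z A) → f ∘ h ≈ g ∘ h →
       Σ (Hom Z E) λ u → (m ∘ u ≈ h) × (∀ (v : Hom Z E) → m ∘ v ≈ h → v ≈ u))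

  RegularMono : ∀ {E A} → Hom E A → Set (o ⊔ ℓ ⊔ e)
  RegularMono {E} {A} m = Σ Obj λ B → Σ (Hom A B) λ f → Σ (Hom A B) λ g → IsEqualizer m f g

  IsPullback : ∀ {P A B X} → Hom P A → Hom P B → Hom A X → Hom B X → Set (o ⊔ ℓ ⊔ e)
  IsPullback {P} {A} {B} p₁ p₂ f g =
    (f ∘ p₁ ≈ g ∘ p₂) ×
    (∀ {Z} (h₁ : Hom Z A) (h₂ : Hom Z B) → f ∘ h₁ ≈ g ∘ h₂ →
       Σ (Hom Z P) λ u → (p₁ ∘ u ≈ h₁) × (p₂ ∘ u ≈ h₂) ×
         (∀ (v : Hom Z P) → p₁ ∘ v ≈ h₁ → p₂ ∘ v ≈ h₂ → v ≈ u))

  IsPushout : ∀ {X A B Q} → Hom X A → Hom X B → Hom A Q → Hom B Q → Set (o ⊔ ℓ ⊔ e)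
  IsPushout {X} {A} {B} {Q} f g i₁ i₂ =
    (i₁ ∘ f ≈ i₂ ∘ g) ×
    (∀ {Z} (h₁ : Hom A Z) (h₂ : Hom B Z) → h₁ ∘ f ≈ h₂ ∘ g →
       Σ (Hom Q Z) λ u → (u ∘ i₁ ≈ h₁) × (u ∘ i₂ ≈ h₂) ×
         (∀ (v : Hom Q Z) → v ∘ i₁ ≈ h₁ → v ∘ i₂ ≈ h₂ → v ≈ u))

  record Terminal : Set (o ⊔ ℓ ⊔ e) where
    field
      ⊤ : Obj
      ! : ∀ {A} → Hom A ⊤
      !-unique : ∀ {A} (f : Hom A ⊤) → f ≈ !

  record Initial : Set (o ⊔ ℓ ⊔ e) where
    field
      ⊥ : Obj
      ¡ : ∀ {A} → Hom ⊥ A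
      ¡-unique : ∀ {A} (f : Hom ⊥ A) → f ≈ ¡

  record Pullback {A B X} (f : Hom A X) (g : Hom B X) : Set (o ⊔ ℓ ⊔ e) where
    field
      P  : Obj
      p₁ : Hom P A
      p₂ : Hom P B
      isPullback : IsPullback p₁ p₂ f g

  record Pushout {X A B} (f : Hom X A) (g : Hom X B) : Set (o ⊔ ℓ ⊔ e) where
    field
      Q  : Obj
      i₁ : Hom A Q
      i₂ : Hom B Q
      isPushout : IsPushout f g i₁ i₂

  HasPullbacks : Set (o ⊔ ℓ ⊔ e)
  HasPullbacks = ∀ {A B X} (f : Hom A X) (g : Hom B X) → Pullback f g

  HasPushouts : Set (o ⊔ ℓ ⊔ e)
  HasPushouts = ∀ {X A B} (f : Hom X A) (g : Hom X B) → Pushout f g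

  -- Locally cartesian closed: every slice C/X is cartesian closed.
  -- Binary products in C/X are pullbacks over X; the terminal object of C/X
  -- is id : X → X (always present).  An exponential in C/X of
  -- (B , b) by (A , a) is an object (E , e) of C/X with an evaluation map
  -- ev : (E , e) ×_X (A , a) → (B , b) in C/X, universal in the usual sense.
  module _ (pb : HasPullbacks) where
    record SliceExponential {X A B} (a : Hom A X) (b : Hom B X) : Set (o ⊔ ℓ ⊔ e) where
      field
        E  : Obj
        e' : Hom E X
      private
        module PE = Pullback (pb e' a)
      field
        ev : Hom PE.P B
        ev-over : b ∘ ev ≈ a ∘ PE.p₂
        curry : ∀ {Z} (z : Hom Z X) (g : Hom (Pullback.P (pb z a)) B) →
                b ∘ g ≈ a ∘ Pullback.p₂ (pb z a) →
                Σ (Hom Z E) λ h → (e' ∘ h ≈ z) ×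
                  -- ev ∘ (h ×_X id_A) = g, where h ×_X id_A is any (hence the
                  -- unique) map k with p₁ ∘ k = h ∘ q₁ and p₂ ∘ k = q₂
                  (∀ (k : Hom (Pullback.P (pb z a)) PE.P) →
                     PE.p₁ ∘ k ≈ h ∘ Pullback.p₁ (pb z a) →
                     PE.p₂ ∘ k ≈ Pullback.p₂ (pb z a) → ev ∘ k ≈ g) ×
                  (∀ (h' : Hom Z E) → e' ∘ h' ≈ z →
                     (∀ (k : Hom (Pullback.P (pb z a)) PE.P) →
                        PE.p₁ ∘ k ≈ h' ∘ Pullback.p₁ (pb z a) →
                        PE.p₂ ∘ k ≈ Pullback.p₂ (pb z a) → ev ∘ k ≈ g) →
                     h' ≈ h)

    LocallyCartesianClosed : Set (o ⊔ ℓ ⊔ e)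
    LocallyCartesianClosed = ∀ {X A B} (a : Hom A X) (b : Hom B X) → SliceExponential a b

  record RegularSubobjectClassifier (T : Terminal) : Set (o ⊔ ℓ ⊔ e) where
    open Terminal T renaming (⊤ to 𝟙)
    field
      Ω    : Obj
      true : Hom 𝟙 Ω
      classify : ∀ {A X} (m : Hom A X) → RegularMono m →
        Σ (Hom X Ω) λ χ → IsPullback m ! χ true ×
          (∀ (χ' : Hom X Ω) → IsPullback m ! χ' true → χ' ≈ χ)

record Quasitopos (o ℓ e : Level) : Set (suc (o ⊔ ℓ ⊔ e)) where
  field
    C : Category o ℓ e
  open Category C public
  open Notions C public
  field
    terminal  : Terminal
    pullbacks : HasPullbacks
    initial   : Initial
    pushouts  : HasPushouts
    lcc       : LocallyCartesianClosed pullbacks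
    classifier : RegularSubobjectClassifier terminal

record PartialMapClassifier {o ℓ e} (Q : Quasitopos o ℓ e) : Set (o ⊔ ℓ ⊔ e) where
  open Quasitopos Q
  field
    T    : Obj → Obj
    Tmap : ∀ {A B} → Hom A B → Hom (T A) (T B)
    T-id : ∀ {A} → Tmap (id {A}) ≈ id
    T-∘  : ∀ {A B D} (f : Hom A B) (g : Hom B D) → Tmap (g ∘ f) ≈ Tmap g ∘ Tmap f
    T-resp-≈ : ∀ {A B} {f g : Hom A B} → f ≈ g → Tmap f ≈ Tmap g
    η    : ∀ X → Hom X (T X)
    η-natural : ∀ {A B} (f : Hom A B) → η B ∘ f ≈ Tmap f ∘ η A
    η-regular : ∀ X → RegularMono (η X)
    classify : ∀ {A X B} (m : Hom X A) (f : Hom X B) → RegularMono m →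
      Σ (Hom A (T B)) λ u → IsPullback m f u (η B) ×
        (∀ (u' : Hom A (T B)) → IsPullback m f u' (η B) → u' ≈ u)

RestrictedClassifier : ∀ {o ℓ e} {Q : Quasitopos o ℓ e} → PartialMapClassifier Q →
  ∀ {L L'} → Quasitopos.Hom Q L L' → Set (o ⊔ ℓ ⊔ e)
RestrictedClassifier {Q = Q} P {L} {L'} t =
  RegularMono t × Σ (Hom L' (T L)) λ s → Mono s × (s ∘ t ≈ η L)
  where
    open Quasitopos Q
    open PartialMapClassifier P

{-# OPTIONS --safe #-}
module Submission where

-- Post-composing with the mono s : L' → T L turns the pullback square
-- witnessing α into one exhibiting s ∘ α as the classifying map of the
-- partial map (m , id_L), since s ∘ t = η_L.  Classifying maps are unique,
-- so s ∘ α = s ∘ β, and s is mono.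

open import Defs
open import Level using (Level)
open import Data.Product using (_,_)
open import Relation.Binary using (IsEquivalence; Setoid)
import Relation.Binary.Reasoning.Setoid as SetoidReasoning

module PullbackProperties {o ℓ e : Level} (C : Category o ℓ e) where
  open Category C
  open Notions C

  private
    open module ≈ {A B} = IsEquivalence (≈-equiv {A} {B})

    hom-setoid : ∀ {A B} → Setoid ℓ e
    hom-setoid {A} {B} = record { Carrier = Hom A B ; _≈_ = _≈_ ; isEquivalence = ≈-equiv }

  IsPullback-swap : ∀ {P A B X} {p₁ : Hom P A} {p₂ : Hom P B} {f : Hom A X} {g : Hom B X} →
                    IsPullback p₁ p₂ f g → IsPullback p₂ p₁ g f
  IsPullback-swap (commutes , universal) =
    sym commutes , λ h₁ h₂ eq →
      let (u , p₁u , p₂u , unique) = universal h₂ h₁ (sym eq)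
      in u , p₂u , p₁u , λ v q₂ q₁ → unique v q₁ q₂

  IsPullback-resp-≈ : ∀ {P A B X} {p₁ : Hom P A} {p₂ : Hom P B} {f f' : Hom A X} {g g' : Hom B X} →
                      f ≈ f' → g ≈ g' → IsPullback p₁ p₂ f g → IsPullback p₁ p₂ f' g'
  IsPullback-resp-≈ f≈f' g≈g' (commutes , universal) =
    trans (∘-resp-≈ (sym f≈f') refl) (trans commutes (∘-resp-≈ g≈g' refl)) ,
    λ h₁ h₂ eq → universal h₁ h₂ (trans (∘-resp-≈ f≈f' refl) (trans eq (∘-resp-≈ (sym g≈g') refl)))

  -- Commuting after s forces commuting before, so cones over (s ∘ f , s ∘ g)
  -- are exactly the cones over (f , g).
  IsPullback-∘-mono : ∀ {P A B X Y} {p₁ : Hom P A} {p₂ : Hom P B} {f : Hom A X} {g : Hom B X}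
                      {s : Hom X Y} → Mono s →
                      IsPullback p₁ p₂ f g → IsPullback p₁ p₂ (s ∘ f) (s ∘ g)
  IsPullback-∘-mono {P} {Y = Y} {p₁ = p₁} {p₂} {f} {g} {s} s-mono (commutes , universal) =
    commutes′ , λ h₁ h₂ eq → universal h₁ h₂ (s-mono (f ∘ h₁) (g ∘ h₂) (reassoc eq))
    where
      open SetoidReasoning (hom-setoid {P} {Y})

      reassoc : ∀ {Z} {h₁ : Hom Z _} {h₂ : Hom Z _} →
                (s ∘ f) ∘ h₁ ≈ (s ∘ g) ∘ h₂ → s ∘ (f ∘ h₁) ≈ s ∘ (g ∘ h₂)
      reassoc eq = trans (sym assoc) (trans eq assoc)

      commutes′ : (s ∘ f) ∘ p₁ ≈ (s ∘ g) ∘ p₂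
      commutes′ = begin
        (s ∘ f) ∘ p₁ ≈⟨ assoc ⟩
        s ∘ (f ∘ p₁) ≈⟨ ∘-resp-≈ refl commutes ⟩
        s ∘ (g ∘ p₂) ≈⟨ sym assoc ⟩
        (s ∘ g) ∘ p₂ ∎

module _ {o ℓ e : Level} {Q : Quasitopos o ℓ e} (P : PartialMapClassifier Q) where
  open Quasitopos Q
  open PartialMapClassifier P
  open PullbackProperties C
  open module ≈ {A B} = IsEquivalence (≈-equiv {A} {B})

  classify-unique : ∀ {A X B} {m : Hom X A} {f : Hom X B} → RegularMono m →
                    {u v : Hom A (T B)} →
                    IsPullback m f u (η B) → IsPullback m f v (η B) → u ≈ v
  classify-unique {m = m} {f} m-regular u-pb v-pb =
    let (_ , _ , unique) = classify m f m-regular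
    in trans (unique _ u-pb) (sym (unique _ v-pb))

  restricted-classifies : ∀ {L L' G} {t : Hom L L'} {m : Hom L G} {s : Hom L' (T L)} →
                          Mono s → s ∘ t ≈ η L → {α : Hom G L'} →
                          IsPullback id m t α → IsPullback m id (s ∘ α) (η L)
  restricted-classifies s-mono st≈η α-pb =
    IsPullback-resp-≈ refl st≈η (IsPullback-∘-mono s-mono (IsPullback-swap α-pb))

lemma4 : ∀ {o ℓ e : Level} (Q : Quasitopos o ℓ e) (P : PartialMapClassifier Q) →
         let open Quasitopos Q in
         ∀ {L L' G : Obj} (t : Hom L L') (m : Hom L G) →
         RegularMono t → RegularMono m → RestrictedClassifier P t →
         ∀ (α β : Hom G L') →
         α ∘ m ≈ t → IsPullback id m t α →
         β ∘ m ≈ t → IsPullback id m t β →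
         α ≈ β
lemma4 Q P t m _ m-regular (_ , s , s-mono , st≈η) α β _ α-pb _ β-pb =
  s-mono α β (classify-unique P m-regular
                (restricted-classifies P s-mono st≈η α-pb)
                (restricted-classifies P s-mono st≈η β-pb))
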